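{- Let $n$ elements be partitioned into gaps $\Delta_1,\dots,\Delta_m$ and let $B=\sum_{j=1}^m|\Delta_j|\log_2(n/|\Delta_j|)$. Suppose an element is inserted into gap $\Delta_i$, so that $|\Delta_i|$ and $n$ both increase by one, and let $B'$ be the corresponding quantity afterwards. Then the quantity $B+n$ increases by $\Omega(\log(n/|\Delta_i|))$, i.e. there is an absolute constant $\kappa>0$ with $(B'+n+1)-(B+n)\ge\kappa\log(n/|\Delta_i|)$, where $n$ and $|\Delta_i|$ denote the values before the insertion.
   Context: $\log_2$ is the binary logarithm and $\log(x)=\max(\log_2 x,1)$. Gaps are nonempty finite multisets partitioning the elements. -}

module Defs where

open import Data.Nat using (ℕ; suc; _+_; _*_; _^_; _≤_)
open import Data.List using (List; map; length; lookup; updateAt)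
open import Data.Nat.ListAction using (sum; product)
open import Data.Fin using (Fin)
open import Data.Product using (_×_)

-- A configuration of gaps is given by the list of gap sizes |Δ_1|,...,|Δ_m|
-- (each gap is a nonempty multiset, so every size is ≥ 1; the total is n).
Gaps : Set
Gaps = List ℕ

total : Gaps → ℕ
total = sum

-- No reals in agda-stdlib: we work with 2^B instead of B.
--   2^B = ∏_j (n/|Δ_j|)^{|Δ_j|} = n^n / ∏_j |Δ_j|^{|Δ_j|} = Bnum g / Bden g
Bnum : Gaps → ℕ
Bnum g = total g ^ total g

Bden : Gaps → ℕ
Bden g = product (map (λ s → s ^ s) g)

insert : (g : Gaps) → Fin (length g) → Gaps
insert g i = updateAt g i suc

-- For positive rationals a/b and x/y, with κ = p/q:
--   (a/b)^q ≥ max(x/y , 2)^p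
-- i.e.  q·log₂(a/b) ≥ p·log(x/y)  with log(z) = max(log₂ z, 1),
-- written with denominators cleared.
PowGeLog : (a b x y p q : ℕ) → Set
PowGeLog a b x y p q = (b ^ q * x ^ p ≤ a ^ q * y ^ p) × (b ^ q * 2 ^ p ≤ a ^ q)

-- The theorem's conclusion  (B' + n' ) - (B + n) ≥ κ · log(n/d)
-- where n' = n+1, κ = p/q, d = |Δ_i| before insertion.
-- 2^{(B'+n+1)-(B+n)} = 2 · (Bnum g' / Bden g') · (Bden g / Bnum g).
IncreaseBound : (p q : ℕ) (g : Gaps) (i : Fin (length g)) → Set
IncreaseBound p q g i =
  PowGeLog (2 * Bnum (insert g i) * Bden g) (Bden (insert g i) * Bnum g)
           (total g) (lookup g i) p q

-- Only the growing gap changes its factor, so 2 to the power of the increase is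
-- 2(n+1)(1+1/n)^n / ((d+1)(1+1/d)^d) with d = |Δ_i|. Bernoulli gives (1+1/n)^n ≥ 2, and since
-- (1+1/d)^(d+1) decreases, (1+1/d)^(d+1) ≤ 4 and (1+1/d)^d ≤ 27/8 for d ≥ 1. So the ratio is at
-- least n/d and at least 32/27, and (32/27)^5 > 2 makes κ = 1/5 work.

module Submission where

open import Data.Fin using (Fin; zero; suc)
open import Data.List using (List; _∷_; length; lookup; updateAt; map)
open import Data.List.Membership.Propositional.Properties using (∈-lookup)
open import Data.List.Relation.Unary.All as All using (All)
open import Data.Nat
  using (ℕ; zero; suc; _+_; _*_; _^_; _≤_; _<_; _≤′_; ≤′-refl; ≤′-step; z≤n; s≤s; >-nonZero)
open import Data.Nat.ListAction using (sum; product)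
open import Data.Nat.Properties
open import Algebra.Properties.CommutativeSemigroup *-commutativeSemigroup
  using (x∙yz≈y∙xz; xy∙z≈xz∙y)
open import Data.Nat.Solver using (module +-*-Solver)
open import Data.Product using (Σ; ∃; _×_; _,_)
open import Relation.Binary.PropositionalEquality
  using (_≡_; refl; sym; trans; cong; cong₂; subst₂)

open import Defs

open +-*-Solver
open ≤-Reasoning

^-distribʳ-* : ∀ m n o → (m * n) ^ o ≡ m ^ o * n ^ o
^-distribʳ-* m n zero    = refl
^-distribʳ-* m n (suc o) = begin-equality
  m * n * (m * n) ^ o     ≡⟨ cong (m * n *_) (^-distribʳ-* m n o) ⟩
  m * n * (m ^ o * n ^ o) ≡⟨ solve 4 (λ m n x y → m :* n :* (x :* y) := m :* x :* (n :* y))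
                               refl m n (m ^ o) (n ^ o) ⟩
  m * m ^ o * (n * n ^ o) ∎

bernoulli : ∀ N j → N ^ j * (N + j) ≤ N * suc N ^ j
bernoulli N zero    = ≤-reflexive (solve 1 (λ N → con 1 :* (N :+ con 0) := N :* con 1) refl N)
bernoulli N (suc j) = begin
  N * N ^ j * (N + suc j)             ≤⟨ m≤m+n _ (N ^ j * j) ⟩
  N * N ^ j * (N + suc j) + N ^ j * j ≡⟨ solve 3 (λ N X j → N :* X :* (N :+ (con 1 :+ j)) :+ X :* j
                                                        := (con 1 :+ N) :* (X :* (N :+ j)))
                                           refl N (N ^ j) j ⟩
  suc N * (N ^ j * (N + j))           ≤⟨ *-monoʳ-≤ (suc N) (bernoulli N j) ⟩
  suc N * (N * suc N ^ j)             ≡⟨ x∙yz≈y∙xz (suc N) N (suc N ^ j) ⟩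
  N * (suc N * suc N ^ j)             ∎

2*n^n≤[1+n]^n : ∀ {n} → 1 ≤ n → 2 * n ^ n ≤ suc n ^ n
2*n^n≤[1+n]^n {n} 1≤n = *-cancelʳ-≤ _ _ n {{>-nonZero 1≤n}} (begin
  2 * n ^ n * n   ≡⟨ solve 2 (λ x n → con 2 :* x :* n := x :* (n :+ n)) refl (n ^ n) n ⟩
  n ^ n * (n + n) ≤⟨ bernoulli n n ⟩
  n * suc n ^ n   ≡⟨ *-comm n _ ⟩
  suc n ^ n * n   ∎)

cross-≤-trans : ∀ {a₁ b₁ a₂ b₂ a₃ b₃} → 0 < b₂ →
                a₁ * b₂ ≤ a₂ * b₁ → a₂ * b₃ ≤ a₃ * b₂ → a₁ * b₃ ≤ a₃ * b₁
cross-≤-trans {a₁} {b₁} {a₂} {b₂} {a₃} {b₃} b₂>0 le₁₂ le₂₃ =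
  *-cancelʳ-≤ _ _ b₂ {{>-nonZero b₂>0}} (begin
    a₁ * b₃ * b₂   ≡⟨ xy∙z≈xz∙y a₁ b₃ b₂ ⟩
    a₁ * b₂ * b₃   ≤⟨ *-monoˡ-≤ b₃ le₁₂ ⟩
    a₂ * b₁ * b₃   ≡⟨ solve 3 (λ a b c → a :* b :* c := b :* (a :* c)) refl a₂ b₁ b₃ ⟩
    b₁ * (a₂ * b₃) ≤⟨ *-monoʳ-≤ b₁ le₂₃ ⟩
    b₁ * (a₃ * b₂) ≡⟨ solve 3 (λ a b c → b :* (a :* c) := a :* b :* c) refl a₃ b₁ b₂ ⟩
    a₃ * b₁ * b₂   ∎)

-- With S = (d+1)² and T = (d+2)d = S - 1, the claim reads (d+2) T^(d+1) ≤ (d+1) S^(d+1);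
-- it follows from Bernoulli for (1 + 1/S)^(d+1) together with T (S+1) ≤ S².
euler-step : ∀ d → suc (suc d) ^ suc (suc d) * d ^ suc d ≤ suc d ^ suc d * suc d ^ suc (suc d)
euler-step d = *-cancelʳ-≤ _ _ Q {{>-nonZero Q>0}} (begin
  a * a ^ m * d ^ m * Q          ≡⟨ cong (_* Q) (trans (*-assoc a (a ^ m) (d ^ m))
                                                       (cong (a *_) (sym (^-distribʳ-* a d m)))) ⟩
  a * T ^ m * Q                  ≤⟨ *-monoʳ-≤ (a * T ^ m) (bernoulli S m) ⟩
  a * T ^ m * (S * suc S ^ m)    ≡⟨ solve 4 (λ a x s y → a :* x :* (s :* y) := a :* s :* (x :* y))
                                      refl a (T ^ m) S (suc S ^ m) ⟩
  a * S * (T ^ m * suc S ^ m)    ≡⟨ cong (a * S *_) (sym (^-distribʳ-* T (suc S) m)) ⟩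
  a * S * (T * suc S) ^ m        ≤⟨ *-monoʳ-≤ (a * S) (^-monoˡ-≤ m T*[1+S]≤S*S) ⟩
  a * S * (S * S) ^ m            ≡⟨ cong₂ _*_ aS≡b[S+m] (^-distribʳ-* S S m) ⟩
  b * (S + m) * (S ^ m * S ^ m)  ≡⟨ solve 3 (λ b u x → b :* u :* (x :* x) := b :* x :* (x :* u))
                                      refl b (S + m) (S ^ m) ⟩
  b * S ^ m * Q                  ≡⟨ cong (λ z → b * z * Q) (^-distribʳ-* b b m) ⟩
  b * (b ^ m * b ^ m) * Q        ≡⟨ cong (_* Q) (x∙yz≈y∙xz b (b ^ m) (b ^ m)) ⟩
  b ^ m * (b * b ^ m) * Q        ∎)
  where
  a = suc (suc d)
  b = suc d
  m = suc d
  S = b * b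
  T = a * d
  Q = S ^ m * (S + m)
  Q>0 : 0 < Q
  Q>0 = *-mono-≤ (m^n>0 S m) (s≤s z≤n)
  T*[1+S]≤S*S : T * suc S ≤ S * S
  T*[1+S]≤S*S = ≤-trans (m≤m+n _ 1) (≤-reflexive
    (solve 1 (λ d → (con 2 :+ d) :* d :* (con 1 :+ (con 1 :+ d) :* (con 1 :+ d)) :+ con 1
                 := (con 1 :+ d) :* (con 1 :+ d) :* ((con 1 :+ d) :* (con 1 :+ d)))
       refl d))
  aS≡b[S+m] : a * S ≡ b * (S + m)
  aS≡b[S+m] = solve 1 (λ d → (con 2 :+ d) :* ((con 1 :+ d) :* (con 1 :+ d))
                          := (con 1 :+ d) :* ((con 1 :+ d) :* (con 1 :+ d) :+ (con 1 :+ d)))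
                refl d

euler-antitone : ∀ {c d} → 1 ≤ c → c ≤ d → suc d ^ suc d * c ^ suc c ≤ suc c ^ suc c * d ^ suc d
euler-antitone {c} 1≤c c≤d = go (≤⇒≤′ c≤d)
  where
  go : ∀ {d} → c ≤′ d → suc d ^ suc d * c ^ suc c ≤ suc c ^ suc c * d ^ suc d
  go ≤′-refl             = ≤-refl
  go (≤′-step {d} c≤′d) =
    cross-≤-trans {a₁ = suc (suc d) ^ suc (suc d)} {suc d ^ suc (suc d)} {suc d ^ suc d} {d ^ suc d}
                  {suc c ^ suc c} {c ^ suc c}
      (m^n>0 d {{>-nonZero (≤-trans 1≤c (≤′⇒≤ c≤′d))}} (suc d)) (euler-step d) (go c≤′d)

[1+d]^[1+d]≤4*d^[1+d] : ∀ {d} → 1 ≤ d → suc d ^ suc d ≤ 4 * d ^ suc d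
[1+d]^[1+d]≤4*d^[1+d] {d} 1≤d = begin
  suc d ^ suc d     ≡⟨ sym (*-identityʳ _) ⟩
  suc d ^ suc d * 1 ≤⟨ euler-antitone {1} {d} ≤-refl 1≤d ⟩
  4 * d ^ suc d     ∎

8*[1+d]^d≤27*d^d : ∀ {d} → 1 ≤ d → 8 * suc d ^ d ≤ 27 * d ^ d
8*[1+d]^d≤27*d^d {suc zero}    _ = ≤ᵇ⇒≤ 16 27 _
8*[1+d]^d≤27*d^d {d@(suc (suc _))} _ = *-cancelʳ-≤ _ _ d (begin
  8 * suc d ^ d * d       ≤⟨ *-monoʳ-≤ (8 * suc d ^ d) (n≤1+n d) ⟩
  8 * suc d ^ d * suc d   ≡⟨ solve 2 (λ x e → con 8 :* x :* e := e :* x :* con 8) refl (suc d ^ d) (suc d) ⟩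
  suc d * suc d ^ d * 8   ≤⟨ euler-antitone {2} {d} (s≤s z≤n) (s≤s (s≤s z≤n)) ⟩
  27 * (d * d ^ d)        ≡⟨ solve 2 (λ x e → con 27 :* (e :* x) := con 27 :* x :* e) refl (d ^ d) d ⟩
  27 * d ^ d * d          ∎)

-- 2^((B'+n+1)−(B+n)) = gainNum n d / gainDen n d, for total n and growing gap of size d.
gainNum : ℕ → ℕ → ℕ
gainNum n d = 2 * suc n ^ suc n * d ^ d

gainDen : ℕ → ℕ → ℕ
gainDen n d = suc d ^ suc d * n ^ n

gainDen*n≤gainNum*d : ∀ {n d} → 1 ≤ n → 1 ≤ d → gainDen n d * n ≤ gainNum n d * d
gainDen*n≤gainNum*d {n} {d} 1≤n 1≤d = *-cancelˡ-≤ 2 (begin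
  2 * (suc d ^ suc d * n ^ n * n)     ≡⟨ solve 3 (λ a x n → con 2 :* (a :* x :* n) := a :* (con 2 :* x :* n))
                                           refl (suc d ^ suc d) (n ^ n) n ⟩
  suc d ^ suc d * (2 * n ^ n * n)     ≤⟨ *-mono-≤ ([1+d]^[1+d]≤4*d^[1+d] 1≤d)
                                                  (*-mono-≤ (2*n^n≤[1+n]^n 1≤n) (n≤1+n n)) ⟩
  4 * (d * d ^ d) * (suc n ^ n * suc n) ≡⟨ solve 4 (λ y d z m → con 4 :* (d :* y) :* (z :* m)
                                                          := con 2 :* (con 2 :* (m :* z) :* y :* d))
                                             refl (d ^ d) d (suc n ^ n) (suc n) ⟩
  2 * (gainNum n d * d)               ∎)

32*gainDen≤27*gainNum : ∀ {n d} → 1 ≤ d → d ≤ n → 32 * gainDen n d ≤ 27 * gainNum n d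
32*gainDen≤27*gainNum {n} {d} 1≤d d≤n = begin
  32 * (suc d * suc d ^ d * n ^ n)           ≡⟨ solve 3 (λ e y x → con 32 :* (e :* y :* x)
                                                             := con 2 :* e :* (con 8 :* y) :* (con 2 :* x))
                                                  refl (suc d) (suc d ^ d) (n ^ n) ⟩
  2 * suc d * (8 * suc d ^ d) * (2 * n ^ n) ≤⟨ *-mono-≤ (*-mono-≤ (*-monoʳ-≤ 2 (s≤s d≤n)) (8*[1+d]^d≤27*d^d 1≤d))
                                                        (2*n^n≤[1+n]^n (≤-trans 1≤d d≤n)) ⟩
  2 * suc n * (27 * d ^ d) * suc n ^ n       ≡⟨ solve 3 (λ m y z → con 2 :* m :* (con 27 :* y) :* z
                                                             := con 27 :* (con 2 :* (m :* z) :* y))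
                                                  refl (suc n) (d ^ d) (suc n ^ n) ⟩
  27 * gainNum n d                           ∎

-- 32/27 > 7/6 and (7/6)^5 > 2.
PowGeLog-1/5 : ∀ {a b x y} → b * x ≤ a * y → 32 * b ≤ 27 * a → PowGeLog a b x y 1 5
PowGeLog-1/5 {a} {b} {x} {y} bx≤ay 32b≤27a = log-part , two-part
  where
  b≤a : b ≤ a
  b≤a = *-cancelˡ-≤ 27 (≤-trans (*-monoˡ-≤ b (≤ᵇ⇒≤ 27 32 _)) 32b≤27a)
  log-part : b ^ 5 * x ^ 1 ≤ a ^ 5 * y ^ 1
  log-part = begin
    b ^ 5 * x ^ 1   ≡⟨ solve 2 (λ b x → b :^ 5 :* x :^ 1 := b :^ 4 :* (b :* x)) refl b x ⟩
    b ^ 4 * (b * x) ≤⟨ *-mono-≤ (^-monoˡ-≤ 4 b≤a) bx≤ay ⟩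
    a ^ 4 * (a * y) ≡⟨ solve 2 (λ a y → a :^ 4 :* (a :* y) := a :^ 5 :* y :^ 1) refl a y ⟩
    a ^ 5 * y ^ 1   ∎
  7b≤6a : 7 * b ≤ 6 * a
  7b≤6a = *-cancelˡ-≤ 27 (begin
    27 * (7 * b) ≡⟨ *-assoc 27 7 b ⟨
    189 * b      ≤⟨ *-monoˡ-≤ b (≤ᵇ⇒≤ 189 192 _) ⟩
    192 * b      ≡⟨ *-assoc 6 32 b ⟩
    6 * (32 * b) ≤⟨ *-monoʳ-≤ 6 32b≤27a ⟩
    6 * (27 * a) ≡⟨ x∙yz≈y∙xz 6 27 a ⟩
    27 * (6 * a) ∎)
  two-part : b ^ 5 * 2 ^ 1 ≤ a ^ 5
  two-part = *-cancelˡ-≤ 7776 (begin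
    7776 * (b ^ 5 * 2 ^ 1) ≡⟨ solve 1 (λ b → con 7776 :* (b :^ 5 :* con 2 :^ 1) := con 15552 :* b :^ 5) refl b ⟩
    15552 * b ^ 5          ≤⟨ *-monoˡ-≤ (b ^ 5) (≤ᵇ⇒≤ 15552 16807 _) ⟩
    16807 * b ^ 5          ≡⟨ solve 1 (λ b → con 16807 :* b :^ 5 := (con 7 :* b) :^ 5) refl b ⟩
    (7 * b) ^ 5            ≤⟨ ^-monoˡ-≤ 5 7b≤6a ⟩
    (6 * a) ^ 5            ≡⟨ solve 1 (λ a → (con 6 :* a) :^ 5 := con 7776 :* a :^ 5) refl a ⟩
    7776 * a ^ 5           ∎)

PowGeLog-*ʳ : ∀ {a b x y p q} P → PowGeLog a b x y p q → PowGeLog (a * P) (b * P) x y p q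
PowGeLog-*ʳ {a} {b} {q = q} P (log-part , two-part) =
  scale log-part ,
  ≤-trans (scale (≤-trans two-part (≤-reflexive (sym (*-identityʳ _))))) (≤-reflexive (*-identityʳ _))
  where
  scale : ∀ {u v} → b ^ q * u ≤ a ^ q * v → (b * P) ^ q * u ≤ (a * P) ^ q * v
  scale {u} {v} le = begin
    (b * P) ^ q * u   ≡⟨ cong (_* u) (^-distribʳ-* b P q) ⟩
    b ^ q * P ^ q * u ≡⟨ xy∙z≈xz∙y (b ^ q) (P ^ q) u ⟩
    b ^ q * u * P ^ q ≤⟨ *-monoˡ-≤ (P ^ q) le ⟩
    a ^ q * v * P ^ q ≡⟨ xy∙z≈xz∙y (a ^ q) v (P ^ q) ⟩
    a ^ q * P ^ q * v ≡⟨ cong (_* v) (^-distribʳ-* a P q) ⟨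
    (a * P) ^ q * v   ∎

gain-PowGeLog : ∀ {n d} → 1 ≤ d → d ≤ n → PowGeLog (gainNum n d) (gainDen n d) n d 1 5
gain-PowGeLog {n} {d} 1≤d d≤n = PowGeLog-1/5 {gainNum n d} {gainDen n d}
  (gainDen*n≤gainNum*d (≤-trans 1≤d d≤n) 1≤d) (32*gainDen≤27*gainNum 1≤d d≤n)

sum-updateAt-suc : ∀ (xs : List ℕ) i → sum (updateAt xs i suc) ≡ suc (sum xs)
sum-updateAt-suc (x ∷ xs) zero    = refl
sum-updateAt-suc (x ∷ xs) (suc i) = trans (cong (x +_) (sum-updateAt-suc xs i)) (+-suc x (sum xs))

lookup≤sum : ∀ (xs : List ℕ) i → lookup xs i ≤ sum xs
lookup≤sum (x ∷ xs) zero    = m≤m+n x (sum xs)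
lookup≤sum (x ∷ xs) (suc i) = ≤-trans (lookup≤sum xs i) (m≤n+m (sum xs) x)

product-map-updateAt : ∀ {A : Set} (f : A → ℕ) (h : A → A) (xs : List A) i → ∃ λ P →
  product (map f xs) ≡ f (lookup xs i) * P × product (map f (updateAt xs i h)) ≡ f (h (lookup xs i)) * P
product-map-updateAt f h (x ∷ xs) zero    = product (map f xs) , refl , refl
product-map-updateAt f h (x ∷ xs) (suc i) with product-map-updateAt f h xs i
... | P , before , after =
  f x * P ,
  trans (cong (f x *_) before) (x∙yz≈y∙xz (f x) (f (lookup xs i)) P) ,
  trans (cong (f x *_) after) (x∙yz≈y∙xz (f x) (f (h (lookup xs i))) P)

insert-gain : ∀ g i → ∃ λ P →
  2 * Bnum (insert g i) * Bden g ≡ gainNum (total g) (lookup g i) * P ×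
  Bden (insert g i) * Bnum g ≡ gainDen (total g) (lookup g i) * P
insert-gain g i with product-map-updateAt (λ s → s ^ s) suc g i
... | P , before , after =
  P ,
  trans (cong₂ (λ t u → 2 * t ^ t * u) (sum-updateAt-suc g i) before)
        (sym (*-assoc (2 * suc n ^ suc n) (d ^ d) P)) ,
  trans (cong (_* n ^ n) after) (xy∙z≈xz∙y (suc d ^ suc d) P (n ^ n))
  where
  n = total g
  d = lookup g i

mainTheorem4 : Σ ℕ (λ p → Σ ℕ (λ q → (1 ≤ p) × (1 ≤ q) ×
                 ((g : Gaps) → All (λ s → 1 ≤ s) g → (i : Fin (length g)) →
                   IncreaseBound p q g i)))
mainTheorem4 = 1 , 5 , s≤s z≤n , s≤s z≤n , bound
  where
  bound : (g : Gaps) → All (λ s → 1 ≤ s) g → (i : Fin (length g)) → IncreaseBound 1 5 g i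
  bound g positive i with insert-gain g i
  ... | P , num≡ , den≡ =
    subst₂ (λ a b → PowGeLog a b n d 1 5) (sym num≡) (sym den≡)
      (PowGeLog-*ʳ {gainNum n d} {gainDen n d} {n} {d} {1} {5} P (gain-PowGeLog 1≤d d≤n))
    where
    n = total g
    d = lookup g i
    1≤d : 1 ≤ d
    1≤d = All.lookup positive (∈-lookup i)
    d≤n : d ≤ n
    d≤n = lookup≤sum g i
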